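{- Suppose $(\mathsf P,\mathsf{Opens})$ is a semitopology and $p\in\mathsf P$. Then the following are equivalent: \begin{enumerate} \item $p$ is weakly regular, or in full: $p\in K(p)$. \item $p_{\between}$ is a closed neighbourhood of $p$. \item The poset of closed neighbourhoods of $p$ ordered by subset inclusion, has a least element. \item $p_{\between}$ is least in the poset of closed neighbourhoods of $p$ ordered by subset inclusion. \end{enumerate}
   Context: A semitopology is a pair $(\mathsf P,\mathsf{Opens})$ with $\mathsf{Opens}\subseteq\mathcal P(\mathsf P)$ containing $\varnothing$ and $\mathsf P$ and closed under arbitrary unions. Points $p,p'$ are intertwined when every open neighbourhood of $p$ intersects every open neighbourhood of $p'$; $p_{\between}$ denotes the set of points intertwined with $p$. $\mathrm{interior}(X)$ is the union of open sets contained in $X$. The closure $\overline X$ is the set of points every open neighbourhood of which intersects $X$; $X$ is closed when $X=\overline X$. A closed neighbourhood of $p$ is a closed set $C$ with $p\in\mathrm{interior}(C)$. The community of $p$ is $K(p)=\mathrm{interior}(p_{\between})$, and $p$ is weakly regular when $p\in K(p)$. -}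

module Defs where

open import Level using (Level; suc; _⊔_)
open import Data.Product using (Σ; ∃; _×_; _,_)
open import Data.Empty.Polymorphic using (⊥)
open import Data.Unit.Polymorphic using (⊤)
open import Function.Bundles using (_⇔_)
open import Relation.Unary using (Pred; _∈_; _⊆_)

-- The collection Opens ⊆ 𝒫(P) is presented as a family of subsets
-- `⟦_⟧ : Idx → Pred Carrier ℓ` (Opens = the image of ⟦_⟧).
record Semitopology (ℓ : Level) : Set (suc ℓ) where
  field
    Carrier : Set ℓ
    Idx     : Set ℓ
    ⟦_⟧     : Idx → Pred Carrier ℓ
    open-∅  : Σ Idx λ o → ∀ x → ⟦ o ⟧ x ⇔ ⊥ {ℓ}
    open-P  : Σ Idx λ o → ∀ x → ⟦ o ⟧ x ⇔ ⊤ {ℓ}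
    open-⋃  : (S : Pred Idx ℓ) →
              Σ Idx λ u → ∀ x → ⟦ u ⟧ x ⇔ (Σ Idx λ o → S o × ⟦ o ⟧ x)

module _ {ℓ : Level} (T : Semitopology ℓ) where
  open Semitopology T

  Meets : Pred Carrier ℓ → Pred Carrier ℓ → Set ℓ
  Meets X Y = Σ Carrier λ x → X x × Y x

  Intertwined : Carrier → Carrier → Set ℓ
  Intertwined p q = ∀ (o o' : Idx) → ⟦ o ⟧ p → ⟦ o' ⟧ q → Meets ⟦ o ⟧ ⟦ o' ⟧

  intertwinedSet : Carrier → Pred Carrier ℓ
  intertwinedSet p q = Intertwined p q

  interior : Pred Carrier ℓ → Pred Carrier ℓ
  interior X x = Σ Idx λ o → (⟦ o ⟧ ⊆ X) × ⟦ o ⟧ x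

  closure : Pred Carrier ℓ → Pred Carrier ℓ
  closure X x = ∀ (o : Idx) → ⟦ o ⟧ x → Meets ⟦ o ⟧ X

  IsClosed : Pred Carrier ℓ → Set ℓ
  IsClosed X = (X ⊆ closure X) × (closure X ⊆ X)

  ClosedNbhd : Carrier → Pred Carrier ℓ → Set ℓ
  ClosedNbhd p C = IsClosed C × (p ∈ interior C)

  K : Carrier → Pred Carrier ℓ
  K p = interior (intertwinedSet p)

  WeaklyRegular : Carrier → Set ℓ
  WeaklyRegular p = p ∈ K p

  IsLeastClosedNbhd : Carrier → Pred Carrier ℓ → Set (suc ℓ)
  IsLeastClosedNbhd p C = ClosedNbhd p C × (∀ (D : Pred Carrier ℓ) → ClosedNbhd p D → C ⊆ D)

  HasLeastClosedNbhd : Carrier → Set (suc ℓ)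
  HasLeastClosedNbhd p = Σ (Pred Carrier ℓ) λ C → IsLeastClosedNbhd p C

-- p_≬ is always closed, and it lies inside every closed neighbourhood C of p
-- (an open set around p inside C meets every open around a point of p_≬).
-- Conversely p_≬ is the intersection of the closures of the open
-- neighbourhoods of p, and each of these is a closed neighbourhood of p; so a
-- least closed neighbourhood lies inside p_≬, and its open core around p
-- witnesses p ∈ interior(p_≬).
module Submission where

open import Defs
open import Level using (Level)
open import Data.Product using (_×_; _,_; proj₁; proj₂)
open import Function.Base using (_∘_)
open import Function.Bundles using (_⇔_; mk⇔)
open import Relation.Unary using (Pred; _∈_; _⊆_)

module _ {ℓ : Level} (T : Semitopology ℓ) where
  open Semitopology T

  interior-mono : {X Y : Pred Carrier ℓ} → X ⊆ Y → interior T X ⊆ interior T Y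
  interior-mono X⊆Y (o , o⊆X , xo) = o , X⊆Y ∘ o⊆X , xo

  ⊆-closure : {X : Pred Carrier ℓ} → X ⊆ closure T X
  ⊆-closure {x = x} xX o xo = x , xo , xX

  closure-idem : {X : Pred Carrier ℓ} → closure T (closure T X) ⊆ closure T X
  closure-idem xcc o xo = let (y , yo , yc) = xcc o xo in yc o yo

  closure-isClosed : (X : Pred Carrier ℓ) → IsClosed T (closure T X)
  closure-isClosed X = ⊆-closure , closure-idem

  open⊆interior : (o : Idx) → ⟦ o ⟧ ⊆ interior T ⟦ o ⟧
  open⊆interior o xo = o , (λ yo → yo) , xo

  closure-open-closedNbhd : ∀ {p} (o : Idx) → ⟦ o ⟧ p → ClosedNbhd T p (closure T ⟦ o ⟧)
  closure-open-closedNbhd o po =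
    closure-isClosed ⟦ o ⟧ , interior-mono ⊆-closure (open⊆interior o po)

  intertwinedSet-closed : ∀ p → IsClosed T (intertwinedSet T p)
  intertwinedSet-closed p = ⊆-closure , λ qc o o' po qo' →
    let (r , ro' , rp) = qc o' qo' in rp o o' po ro'

  intertwinedSet⊆closedNbhd : ∀ {p} {C : Pred Carrier ℓ} → ClosedNbhd T p C →
                              intertwinedSet T p ⊆ C
  intertwinedSet⊆closedNbhd ((_ , closure⊆C) , (o , o⊆C , po)) qp = closure⊆C λ o' qo' →
    let (r , ro , ro') = qp o o' po qo' in r , ro' , o⊆C ro

  ⋂closure-nbhds⇒intertwined : ∀ {p q} → (∀ o → ⟦ o ⟧ p → q ∈ closure T ⟦ o ⟧) →
                                 q ∈ intertwinedSet T p
  ⋂closure-nbhds⇒intertwined qc o o' po qo' =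
    let (r , ro' , ro) = qc o po o' qo' in r , ro , ro'

  leastClosedNbhd⊆intertwinedSet : ∀ {p} {C : Pred Carrier ℓ} → IsLeastClosedNbhd T p C →
                                   C ⊆ intertwinedSet T p
  leastClosedNbhd⊆intertwinedSet (_ , least) qC = ⋂closure-nbhds⇒intertwined λ o po →
    least (closure T ⟦ o ⟧) (closure-open-closedNbhd o po) qC

  weaklyRegular⇒isLeastClosedNbhd : ∀ {p} → WeaklyRegular T p →
                                    IsLeastClosedNbhd T p (intertwinedSet T p)
  weaklyRegular⇒isLeastClosedNbhd {p} wr =
    (intertwinedSet-closed p , wr) , λ _ → intertwinedSet⊆closedNbhd

  hasLeastClosedNbhd⇒weaklyRegular : ∀ {p} → HasLeastClosedNbhd T p → WeaklyRegular T p
  hasLeastClosedNbhd⇒weaklyRegular (C , least@((_ , p∈intC) , _)) =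
    interior-mono (leastClosedNbhd⊆intertwinedSet least) p∈intC

proposition5p28 : {ℓ : Level} (T : Semitopology ℓ) (p : Semitopology.Carrier T) →
    (WeaklyRegular T p ⇔ ClosedNbhd T p (intertwinedSet T p))
    × (WeaklyRegular T p ⇔ HasLeastClosedNbhd T p)
    × (WeaklyRegular T p ⇔ IsLeastClosedNbhd T p (intertwinedSet T p))
proposition5p28 T p =
    mk⇔ (proj₁ ∘ weaklyRegular⇒isLeastClosedNbhd T) proj₂
  , mk⇔ (λ wr → _ , weaklyRegular⇒isLeastClosedNbhd T wr) (hasLeastClosedNbhd⇒weaklyRegular T)
  , mk⇔ (weaklyRegular⇒isLeastClosedNbhd T) (proj₂ ∘ proj₁)
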